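{- Let $A=\{a_s(n_s)\}_{s=1}^k$ be a finite system of residue classes and let $m_1,\ldots,m_k\in\mathbb{Z}$. Let $F$ be a field containing an element $\zeta$ of (multiplicative) order $N_A$, and let $f(x_1,\ldots,x_k)$ be a polynomial over $F$ with $\deg f\leqslant m(A)$. If $\big[\prod_{s\in I_z}x_s\big]f(x_1,\ldots,x_k)=0$ for all $z\in\mathbb{Z}$, then $\psi(\theta)=0$ for every $0\leqslant\theta<1$, where $$\psi(\theta):=\sum_{\substack{I\subseteq[1,k]\\ \{\sum_{s\in I}m_s/n_s\}=\theta}}(-1)^{|I|}f([\![1\in I]\!],\ldots,[\![k\in I]\!])\,\zeta^{N_A\sum_{s\in I}a_sm_s/n_s}.$$ The converse holds when $m_1,\ldots,m_k$ are relatively prime to $n_1,\ldots,n_k$ respectively.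
   Context: For $a\in\mathbb{Z}$ and $n\in\mathbb{Z}^+$, $a(n)=a+n\mathbb{Z}$ denotes a residue class. For the system $A=\{a_s(n_s)\}_{s=1}^k$, the covering function is $w_A(x)=|\{1\leqslant s\leqslant k:\, x\in a_s(n_s)\}|$, the covering multiplicity is $m(A)=\min_{x\in\mathbb{Z}}w_A(x)$, $I_z=\{1\leqslant s\leqslant k:\, z\in a_s(n_s)\}$ for $z\in\mathbb{Z}$, and $N_A$ is the least common multiple of $n_1,\ldots,n_k$. $[1,k]=\{1,\ldots,k\}$; $[\![P]\!]$ equals $1$ if the predicate $P$ holds and $0$ otherwise; $\{x\}$ denotes the fractional part of a real number $x$; $\big[\prod_{s\in I}x_s\big]f$ denotes the coefficient of the monomial $\prod_{s\in I}x_s$ in $f$.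
   Formalization: The parameter θ in the conclusion ψ(θ) = 0, and in the hypothesis of the converse, ranges over rational numbers with 0 ≤ θ < 1 rather than over real ones. -}

module Defs where

open import Level using (Level; _⊔_) renaming (suc to lsuc)
open import Data.Bool using (Bool; true; false; if_then_else_)
open import Data.Nat as ℕ using (ℕ; zero; suc; NonZero)
import Data.Nat.Divisibility as ℕD
open import Data.Nat.LCM using (lcm)
open import Data.Integer as ℤ using (ℤ; +_; -[1+_]; ∣_∣)
import Data.Integer.Divisibility as ℤD
import Data.Rational as ℚ
open ℚ using (ℚ)
open import Data.Fin using (Fin)
import Data.Fin.Properties as FinP
open import Data.Vec using (Vec; []; _∷_; lookup)
open import Data.List using (List; []; _∷_; map; foldr; allFin; filter; length; concatMap)
open import Data.Product using (_×_; _,_; proj₁; proj₂; ∃)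
open import Algebra.Bundles using (CommutativeRing)
open import Relation.Nullary using (¬_; Dec; yes; no)
open import Relation.Nullary.Decidable using (⌊_⌋)
open import Relation.Binary.PropositionalEquality using (_≡_)

-- Fields (not in agda-stdlib): a commutative ring with 1 ≠ 0 in which
-- every nonzero element is invertible.  As in Mathlib, the inverse is a
-- total function whose value at 0 is unconstrained.

record Field (c ℓ : Level) : Set (lsuc (c ⊔ ℓ)) where
  field
    commutativeRing : CommutativeRing c ℓ
  open CommutativeRing commutativeRing public
  field
    _⁻¹       : Carrier → Carrier
    ⁻¹-inverse : ∀ x → ¬ (x ≈ 0#) → (x * (x ⁻¹)) ≈ 1#
    1≉0       : ¬ (1# ≈ 0#)

module FieldOps {c ℓ : Level} (F : Field c ℓ) where
  open Field F

  _^ℕ_ : Carrier → ℕ → Carrier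
  x ^ℕ zero  = 1#
  x ^ℕ suc n = x * (x ^ℕ n)

  _^ℤ_ : Carrier → ℤ → Carrier
  x ^ℤ (+ n)     = x ^ℕ n
  x ^ℤ -[1+ n ] = (x ⁻¹) ^ℕ (suc n)

  Σ : List Carrier → Carrier
  Σ = foldr _+_ 0#

  Π : List Carrier → Carrier
  Π = foldr _*_ 1#

  sign : ℕ → Carrier
  sign n = (- 1#) ^ℕ n

  HasOrder : Carrier → ℕ → Set ℓ
  HasOrder ζ N = (0 ℕ.< N) × ((ζ ^ℕ N) ≈ 1#)
                 × (∀ j → 0 ℕ.< j → j ℕ.< N → ¬ ((ζ ^ℕ j) ≈ 1#))

  -- Polynomials in k variables x_0,…,x_{k-1} over F, represented as a
  -- finite formal sum of terms  c · ∏_s x_s^{e s}  (repetitions allowed).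

  Exponent : ℕ → Set
  Exponent k = Fin k → ℕ

  Poly : ℕ → Set c
  Poly k = List (Carrier × Exponent k)

  totalDegree : ∀ {k} → Exponent k → ℕ
  totalDegree {k} e = foldr ℕ._+_ 0 (map e (allFin k))

  sameExp? : ∀ {k} (e e' : Exponent k) → Dec (∀ s → e s ≡ e' s)
  sameExp? e e' = FinP.all? (λ s → e s ℕ.≟ e' s)

  coeff : ∀ {k} → Poly k → Exponent k → Carrier
  coeff []             e = 0#
  coeff ((a , e') ∷ f) e =
    (if ⌊ sameExp? e' e ⌋ then a else 0#) + coeff f e

  DegreeAtMost : ∀ {k} → Poly k → ℕ → Set ℓ
  DegreeAtMost {k} f d = ∀ (e : Exponent k) → d ℕ.< totalDegree e → coeff f e ≈ 0#

  eval : ∀ {k} → Poly k → (Fin k → Carrier) → Carrier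
  eval {k} f x = Σ (map (λ t → proj₁ t * Π (map (λ s → x s ^ℕ proj₂ t s) (allFin k))) f)

record System (k : ℕ) : Set where
  field
    a     : Fin k → ℤ
    n     : Fin k → ℕ
    n-pos : ∀ s → NonZero (n s)

_∈RC_,_ : ℤ → ℤ → ℕ → Set
x ∈RC a , n = (+ n) ℤD.∣ (x ℤ.- a)

_∈RC?_,_ : ∀ x a n → Dec (x ∈RC a , n)
x ∈RC? a , n = n ℕD.∣? ∣ x ℤ.- a ∣

module _ {k : ℕ} (A : System k) where
  open System A

  I : ℤ → Fin k → Bool
  I z s = ⌊ z ∈RC? a s , n s ⌋

  w : ℤ → ℕ
  w x = length (filter (λ s → z∈? s) (allFin k))
    where z∈? : ∀ s → Dec (x ∈RC a s , n s)
          z∈? s = x ∈RC? a s , n s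

  IsCoveringMultiplicity : ℕ → Set
  IsCoveringMultiplicity m = (∃ λ x → w x ≡ m) × (∀ x → m ℕ.≤ w x)

  N : ℕ
  N = foldr lcm 1 (map n (allFin k))

allSubsets : (k : ℕ) → List (Vec Bool k)
allSubsets zero    = [] ∷ []
allSubsets (suc k) = concatMap (λ v → (false ∷ v) ∷ (true ∷ v) ∷ []) (allSubsets k)

card : ∀ {k} → Vec Bool k → ℕ
card []          = 0
card (false ∷ v) = card v
card (true ∷ v)  = suc (card v)

frac : ℚ → ℚ
frac q = q ℚ.- (ℚ.floor q ℚ./ 1)

module _ {k : ℕ} (A : System k) (m : Fin k → ℤ) where
  open System A

  ratSum : Vec Bool k → ℚ
  ratSum J = foldr ℚ._+_ ℚ.0ℚ
    (map (λ s → if lookup J s then ratio s else ℚ.0ℚ) (allFin k))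
    where ratio : Fin k → ℚ
          ratio s = ℚ._/_ (m s) (n s) {{n-pos s}}

  -- N_A ∑_{s∈J} a_s m_s / n_s  (an integer, computed as ∑ a_s m_s (N_A / n_s))
  expo : Vec Bool k → ℤ
  expo J = foldr ℤ._+_ (+ 0)
    (map (λ s → if lookup J s
                  then a s ℤ.* m s ℤ.* (+ (ℕ._/_ (N A) (n s) {{n-pos s}}))
                  else + 0) (allFin k))

module _ {c ℓ : Level} (F : Field c ℓ) where
  open Field F
  open FieldOps F

  ψ : ∀ {k} (A : System k) (m : Fin k → ℤ) (f : Poly k) (ζ : Carrier) (θ : ℚ) → Carrier
  ψ {k} A m f ζ θ =
    Σ (map term (filter (λ J → frac (ratSum A m J) ℚ.≟ θ) (allSubsets k)))
    where
      term : Vec Bool k → Carrier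
      term J = sign (card J)
             * eval f (λ s → if lookup J s then 1# else 0#)
             * (ζ ^ℤ expo A m J)

  indicatorExp : ∀ {k} (A : System k) → ℤ → Exponent k
  indicatorExp A z s = if I A z s then 1 else 0

-- Group the subsets J ⊆ [1,k] by the residue ρ(J) of N ∑_{s∈J} m_s/n_s modulo N;
-- since {∑_{s∈J} m_s/n_s} = ρ(J)/N, the values of ψ are the class sums c_r, the
-- coefficients of P(x) = ∑_{r<N} c_r x^r. Evaluating at x = ζ^{-z}, expanding f
-- into monomials x^e and summing over J first gives
--   P(ζ^{-z}) = ∑_e [x^e]f · ∏_s (0^{e_s} - ζ^{N (a_s - z) m_s / n_s}).
-- For s ∈ I_z the twist ζ^{N (a_s - z) m_s / n_s} is 1, so the factor vanishes
-- unless e_s > 0; with deg f ≤ m(A) ≤ |I_z| only e = 1_{I_z} survives, and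
-- P(ζ^{-z}) = [∏_{s∈I_z} x_s]f · ∏_s(…). If these coefficients vanish, P vanishes
-- at every power of ζ and a Vandermonde argument kills every c_r. Conversely, ψ = 0
-- makes P = 0, and if m_s is prime to n_s the twist is 1 only for s ∈ I_z, so the
-- product ∏_s(…) is nonzero.

module Submission where

open import Defs
open import Level using (Level)
open import Data.Bool using (Bool; true; false; if_then_else_)
open import Data.Nat as ℕ using (ℕ; zero; suc)
import Data.Nat.Properties as ℕP
import Data.Nat.Divisibility as ℕD
import Data.Nat.DivMod as ℕDM
open import Data.Nat.LCM using (lcm; m∣lcm[m,n]; n∣lcm[m,n])
open import Data.Nat.Coprimality using (Coprime; coprime-divisor)
import Data.Nat.Coprimality as Coprimality
open import Data.Integer as ℤ using (ℤ; +_; -[1+_]; ∣_∣)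
import Data.Integer.Properties as ℤP
import Data.Integer.DivMod as ℤDM
open import Data.Integer.Solver using (module +-*-Solver)
open import Data.Rational as ℚ using (ℚ; mkℚ; 0ℚ; 1ℚ; _≤_; _<_)
import Data.Rational.Properties as ℚP
open import Data.Rational.Unnormalised as ℚᵘ using (mkℚᵘ; *≡*; *≤*; *<*)
import Data.Rational.Unnormalised.Properties as ℚᵘP
open import Data.Fin as Fin using (Fin)
import Data.Fin.Properties as FinP
open import Data.Vec using (Vec; []; _∷_; lookup)
open import Data.List using ([]; _∷_; map; foldr; tabulate; filter; allFin; length; concatMap)
import Data.List.Properties as LP
open import Data.List.Relation.Unary.All using (_∷_)
open import Data.List.Relation.Unary.All.Properties using (all-filter)
open import Data.Product using (_×_; _,_; proj₁; proj₂)
open import Data.Sum using (inj₁; inj₂)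
open import Data.Empty using (⊥-elim)
open import Function.Base using (_∘_)
open import Function.Bundles using (_⇔_; mk⇔; Equivalence)
open import Relation.Nullary using (¬_; Dec; yes; no)
open import Relation.Nullary.Decidable using (⌊_⌋; _×-dec_)
open import Relation.Binary.PropositionalEquality as P using (_≡_; _≢_)

map-allFin : ∀ {a} {A : Set a} {k} (g : Fin k → A) → map g (allFin k) ≡ tabulate g
map-allFin g = LP.map-tabulate (λ s → s) g

∣-lcm-foldr : ∀ {k} (v : Fin k → ℕ) s → v s ℕD.∣ foldr lcm 1 (tabulate v)
∣-lcm-foldr v Fin.zero    = m∣lcm[m,n] (v Fin.zero) _
∣-lcm-foldr v (Fin.suc s) = ℕD.∣-trans (∣-lcm-foldr (λ s → v (Fin.suc s)) s) (n∣lcm[m,n] (v Fin.zero) _)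

count-true : ∀ {a p} {A : Set a} {P : A → Set p} (P? : ∀ x → Dec (P x)) xs →
             foldr ℕ._+_ 0 (map (λ x → if ⌊ P? x ⌋ then 1 else 0) xs) ≡ length (filter P? xs)
count-true P? []       = P.refl
count-true P? (x ∷ xs) with P? x
... | yes _ = P.cong suc (count-true P? xs)
... | no _  = count-true P? xs

Σ-≤-pointwise : ∀ {k} (u v : Fin k → ℕ) → (∀ s → u s ℕ.≤ v s) →
                foldr ℕ._+_ 0 (tabulate u) ℕ.≤ foldr ℕ._+_ 0 (tabulate v)
Σ-≤-pointwise {zero}  u v u≤v = ℕ.z≤n
Σ-≤-pointwise {suc k} u v u≤v = ℕP.+-mono-≤ (u≤v Fin.zero) (Σ-≤-pointwise (u ∘ Fin.suc) (v ∘ Fin.suc) (u≤v ∘ Fin.suc))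

Σ-<-pointwise : ∀ {k} (u v : Fin k → ℕ) → (∀ s → u s ℕ.≤ v s) → ∀ s₀ → u s₀ ≢ v s₀ →
                foldr ℕ._+_ 0 (tabulate u) ℕ.< foldr ℕ._+_ 0 (tabulate v)
Σ-<-pointwise u v u≤v Fin.zero u≢v =
  ℕP.+-mono-<-≤ (ℕP.≤∧≢⇒< (u≤v Fin.zero) u≢v) (Σ-≤-pointwise (u ∘ Fin.suc) (v ∘ Fin.suc) (u≤v ∘ Fin.suc))
Σ-<-pointwise u v u≤v (Fin.suc s₀) u≢v =
  ℕP.+-mono-≤-< (u≤v Fin.zero) (Σ-<-pointwise (u ∘ Fin.suc) (v ∘ Fin.suc) (u≤v ∘ Fin.suc) s₀ u≢v)

sumIf : ∀ {k} → (Fin k → Bool) → (Fin k → ℤ) → ℤ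
sumIf b v = foldr ℤ._+_ (+ 0) (tabulate (λ s → if b s then v s else + 0))

*-distribˡ-sumIf : ∀ {k} w (b : Fin k → Bool) v → w ℤ.* sumIf b v ≡ sumIf b (λ s → w ℤ.* v s)
*-distribˡ-sumIf {zero}  w b v = ℤP.*-zeroʳ w
*-distribˡ-sumIf {suc k} w b v = P.trans (ℤP.*-distribˡ-+ w _ _)
  (P.cong₂ ℤ._+_ (head (b Fin.zero)) (*-distribˡ-sumIf w (λ s → b (Fin.suc s)) (λ s → v (Fin.suc s))))
  where
  head : ∀ b₀ → w ℤ.* (if b₀ then v Fin.zero else + 0) ≡ (if b₀ then w ℤ.* v Fin.zero else + 0)
  head true  = P.refl
  head false = ℤP.*-zeroʳ w

module FractionalPart where

  private
    <-suc-of-cross : ∀ f g A B (X Y : ℕ) .{{_ : ℕ.NonZero X}} .{{_ : ℕ.NonZero Y}} →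
                     f ℤ.* + X ℤ.≤ A → B ℤ.< ℤ.suc g ℤ.* + Y → A ℤ.* + Y ≡ B ℤ.* + X → f ℤ.< ℤ.suc g
    <-suc-of-cross f g A B X@(suc _) Y@(suc _) fX≤A B<[1+g]Y AY≡BX =
      ℤP.*-cancelʳ-<-nonNeg (+ X ℤ.* + Y) (begin-strict
        f ℤ.* (+ X ℤ.* + Y)           ≡⟨ ℤP.*-assoc f (+ X) (+ Y) ⟨
        f ℤ.* + X ℤ.* + Y             ≤⟨ ℤP.*-monoʳ-≤-nonNeg (+ Y) fX≤A ⟩
        A ℤ.* + Y                     ≡⟨ AY≡BX ⟩
        B ℤ.* + X                     <⟨ ℤP.*-monoʳ-<-pos (+ X) B<[1+g]Y ⟩
        ℤ.suc g ℤ.* + Y ℤ.* + X       ≡⟨ ℤP.*-assoc (ℤ.suc g) (+ Y) (+ X) ⟩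
        ℤ.suc g ℤ.* (+ Y ℤ.* + X)     ≡⟨ P.cong (ℤ.suc g ℤ.*_) (ℤP.*-comm (+ Y) (+ X)) ⟩
        ℤ.suc g ℤ.* (+ X ℤ.* + Y)     ∎)
      where open ℤP.≤-Reasoning

    <-suc⇒≤ : ∀ {f g} → f ℤ.< ℤ.suc g → f ℤ.≤ g
    <-suc⇒≤ {f} {g} f<1+g = P.subst (f ℤ.≤_) (ℤP.pred-suc g) (ℤP.i<j⇒i≤pred[j] f<1+g)

  /ℕ-cross : ∀ A B (X Y : ℕ) .{{_ : ℕ.NonZero X}} .{{_ : ℕ.NonZero Y}} →
             A ℤ.* + Y ≡ B ℤ.* + X → A ℤDM./ℕ X ≡ B ℤDM./ℕ Y
  /ℕ-cross A B X Y AY≡BX = ℤP.≤-antisym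
    (<-suc⇒≤ (<-suc-of-cross (A ℤDM./ℕ X) (B ℤDM./ℕ Y) A B X Y
                (ℤDM.[n/ℕd]*d≤n A X) (ℤDM.n<s[n/ℕd]*d B Y) AY≡BX))
    (<-suc⇒≤ (<-suc-of-cross (B ℤDM./ℕ Y) (A ℤDM./ℕ X) B A Y X
                (ℤDM.[n/ℕd]*d≤n B Y) (ℤDM.n<s[n/ℕd]*d A X) (P.sym AY≡BX)))

  toℚᵘ-/ : ∀ i N .{{_ : ℕ.NonZero N}} → ℚ.toℚᵘ (i ℚ./ N) ℚᵘ.≃ (i ℚᵘ./ N)
  toℚᵘ-/ i (suc N) = ℚP.toℚᵘ-fromℚᵘ (mkℚᵘ i N)

  frac-≃ : ∀ q R N .{{_ : ℕ.NonZero N}} → ℚ.toℚᵘ q ℚᵘ.≃ (R ℚᵘ./ N) → frac q ≡ + (R ℤDM.%ℕ N) ℚ./ N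
  frac-≃ q@(mkℚ p D-1 _) R N@(suc N-1) q≃R/N@(*≡* pN≡RD) = ℚP.toℚᵘ-injective (begin
      ℚ.toℚᵘ (q ℚ.- ⌊q⌋ ℚ./ 1)                       ≈⟨ ℚP.toℚᵘ-homo-+ q (ℚ.- (⌊q⌋ ℚ./ 1)) ⟩
      ℚ.toℚᵘ q ℚᵘ.+ ℚ.toℚᵘ (ℚ.- (⌊q⌋ ℚ./ 1))        ≈⟨ ℚᵘP.+-cong q≃R/N
                                                         (ℚᵘP.≃-trans (ℚP.toℚᵘ-homo‿- (⌊q⌋ ℚ./ 1)) (ℚᵘP.-‿cong (toℚᵘ-/ ⌊q⌋ 1))) ⟩
      mkℚᵘ R N-1 ℚᵘ.+ ℚᵘ.- mkℚᵘ ⌊q⌋ 0                 ≈⟨ *≡* numerators ⟩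
      mkℚᵘ (+ ρ) N-1                                  ≈⟨ toℚᵘ-/ (+ ρ) N ⟨
      ℚ.toℚᵘ (+ ρ ℚ./ N)                              ∎)
    where
    open ℚᵘP.≃-Reasoning
    ρ = R ℤDM.%ℕ N
    g = R ℤDM./ℕ N
    ⌊q⌋ = ℚ.floor q
    ⌊q⌋≡g : ⌊q⌋ ≡ g
    ⌊q⌋≡g = P.trans (ℤDM.div-pos-is-/ℕ p (suc D-1)) (/ℕ-cross p R (suc D-1) N pN≡RD)
    numerators : (R ℤ.* + 1 ℤ.+ ℤ.- ⌊q⌋ ℤ.* + N) ℤ.* + N ≡ + ρ ℤ.* + (N ℕ.* 1)
    numerators rewrite ⌊q⌋≡g | ℕP.*-identityʳ N =
      P.trans (P.cong (λ r → (r ℤ.* + 1 ℤ.+ ℤ.- g ℤ.* + N) ℤ.* + N) (ℤDM.a≡a%ℕn+[a/ℕn]*n R N))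
              (solve 3 (λ r g n → ((r :+ g :* n) :* con (+ 1) :+ (:- g) :* n) :* n := r :* n) P.refl (+ ρ) g (+ N))
      where open +-*-Solver

  +/-injective : ∀ N .{{_ : ℕ.NonZero N}} a b → + a ℚ./ N ≡ + b ℚ./ N → a ≡ b
  +/-injective N@(suc N-1) a b a/N≡b/N with ℚP.fromℚᵘ-injective {mkℚᵘ (+ a) N-1} {mkℚᵘ (+ b) N-1} a/N≡b/N
  ... | *≡* aN≡bN = ℤP.+-injective (ℤP.*-cancelʳ-≡ (+ a) (+ b) (+ N) aN≡bN)

  0≤+/ : ∀ N .{{_ : ℕ.NonZero N}} a → 0ℚ ≤ + a ℚ./ N
  0≤+/ N@(suc _) a = ℚP.toℚᵘ-cancel-≤ (ℚᵘP.≤-respʳ-≃ (ℚᵘP.≃-sym (toℚᵘ-/ (+ a) N))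
    (*≤* (P.subst (+ 0 ℤ.≤_) (P.sym (ℤP.*-identityʳ (+ a))) (ℤ.+≤+ ℕ.z≤n))))

  +/<1 : ∀ N .{{_ : ℕ.NonZero N}} a → a ℕ.< N → + a ℚ./ N < 1ℚ
  +/<1 N@(suc _) a a<N = ℚP.toℚᵘ-cancel-< (ℚᵘP.<-respˡ-≃ (ℚᵘP.≃-sym (toℚᵘ-/ (+ a) N))
    (*<* (P.subst₂ ℤ._<_ (P.sym (ℤP.*-identityʳ (+ a))) (P.sym (ℤP.*-identityˡ (+ N))) (ℤ.+<+ a<N))))

  /-scale : ∀ N .{{_ : ℕ.NonZero N}} (m : ℤ) n .{{_ : ℕ.NonZero n}} d → n ℕ.* d ≡ N →
            ℚ.toℚᵘ (m ℚ./ n) ℚᵘ.≃ ((m ℤ.* + d) ℚᵘ./ N)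
  /-scale N@(suc _) m n@(suc n-1) d nd≡N = ℚᵘP.≃-trans (toℚᵘ-/ m n) (*≡* (begin
    m ℤ.* + N                   ≡⟨ P.cong (λ N → m ℤ.* + N) nd≡N ⟨
    m ℤ.* + (n ℕ.* d)           ≡⟨ P.cong (m ℤ.*_) (ℤP.pos-* n d) ⟩
    m ℤ.* (+ n ℤ.* + d)         ≡⟨ solve 3 (λ m n d → m :* (n :* d) := (m :* d) :* n) P.refl m (+ n) (+ d) ⟩
    m ℤ.* + d ℤ.* + n           ∎))
    where open +-*-Solver
          open P.≡-Reasoning

  /-+ : ∀ N .{{_ : ℕ.NonZero N}} a b → (a ℚᵘ./ N) ℚᵘ.+ (b ℚᵘ./ N) ℚᵘ.≃ ((a ℤ.+ b) ℚᵘ./ N)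
  /-+ N@(suc _) a b = *≡* (P.trans
    (solve 3 (λ a b n → (a :* n :+ b :* n) :* n := (a :+ b) :* (n :* n)) P.refl a b (+ N))
    (P.cong ((a ℤ.+ b) ℤ.*_) (P.sym (ℤP.pos-* N N))))
    where open +-*-Solver

  Σ-/ : ∀ N .{{_ : ℕ.NonZero N}} {k} (b : Fin k → Bool) (x : Fin k → ℤ) (q : Fin k → ℚ) →
        (∀ s → ℚ.toℚᵘ (q s) ℚᵘ.≃ (x s ℚᵘ./ N)) →
        ℚ.toℚᵘ (foldr ℚ._+_ 0ℚ (tabulate (λ s → if b s then q s else 0ℚ)))
        ℚᵘ.≃ (sumIf b x ℚᵘ./ N)
  Σ-/ N@(suc _) {zero}  b x q q≃x/N = *≡* P.refl
  Σ-/ N@(suc _) {suc k} b x q q≃x/N = begin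
    ℚ.toℚᵘ (q₀ ℚ.+ qs)                     ≈⟨ ℚP.toℚᵘ-homo-+ q₀ qs ⟩
    ℚ.toℚᵘ q₀ ℚᵘ.+ ℚ.toℚᵘ qs               ≈⟨ ℚᵘP.+-cong (head≃ (b Fin.zero))
                                                (Σ-/ N (b ∘ Fin.suc) (x ∘ Fin.suc) (q ∘ Fin.suc) (q≃x/N ∘ Fin.suc)) ⟩
    (x₀ ℚᵘ./ N) ℚᵘ.+ (xs ℚᵘ./ N)           ≈⟨ /-+ N x₀ xs ⟩
    (x₀ ℤ.+ xs) ℚᵘ./ N                     ∎
    where
    open ℚᵘP.≃-Reasoning
    q₀ = if b Fin.zero then q Fin.zero else 0ℚ
    qs = foldr ℚ._+_ 0ℚ (tabulate (λ s → if b (Fin.suc s) then q (Fin.suc s) else 0ℚ))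
    x₀ = if b Fin.zero then x Fin.zero else + 0
    xs = sumIf (b ∘ Fin.suc) (x ∘ Fin.suc)
    head≃ : ∀ b₀ → ℚ.toℚᵘ (if b₀ then q Fin.zero else 0ℚ) ℚᵘ.≃ ((if b₀ then x Fin.zero else + 0) ℚᵘ./ N)
    head≃ true  = q≃x/N Fin.zero
    head≃ false = *≡* P.refl

module FieldProperties {c ℓ : Level} (F : Field c ℓ) where
  open Field F
  open FieldOps F
  open import Algebra.Properties.Ring ring
    using ([y-z]x≈yx-zx; x∙y⁻¹≈ε⇒x≈y; x≈y⇒x∙y⁻¹≈ε)
  open import Algebra.Properties.CommutativeSemigroup +-commutativeSemigroup using () renaming (interchange to +-interchange)
  open import Algebra.Properties.CommutativeSemigroup *-commutativeSemigroup using () renaming (interchange to *-interchange)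
  open import Algebra.Solver.Ring.NaturalCoefficients.Default commutativeSemiring
    using (solve; _:+_; _:*_; _:=_)
  open import Relation.Binary.Reasoning.Setoid setoid

  x*y≈0⇒x≈0 : ∀ {x y} → ¬ y ≈ 0# → x * y ≈ 0# → x ≈ 0#
  x*y≈0⇒x≈0 {x} {y} y≉0 xy≈0 = begin
    x                ≈⟨ *-identityʳ x ⟨
    x * 1#           ≈⟨ *-congˡ (⁻¹-inverse y y≉0) ⟨
    x * (y * y ⁻¹)   ≈⟨ *-assoc x y (y ⁻¹) ⟨
    (x * y) * y ⁻¹   ≈⟨ *-congʳ xy≈0 ⟩
    0# * y ⁻¹        ≈⟨ zeroˡ (y ⁻¹) ⟩
    0#               ∎

  x*y≉0 : ∀ {x y} → ¬ x ≈ 0# → ¬ y ≈ 0# → ¬ x * y ≈ 0#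
  x*y≉0 x≉0 y≉0 xy≈0 = x≉0 (x*y≈0⇒x≈0 y≉0 xy≈0)

  *-cancelˡ-≉0 : ∀ {x y z} → ¬ x ≈ 0# → x * y ≈ x * z → y ≈ z
  *-cancelˡ-≉0 {x} {y} {z} x≉0 xy≈xz = x∙y⁻¹≈ε⇒x≈y y z (x*y≈0⇒x≈0 x≉0 (begin
    (y - z) * x      ≈⟨ [y-z]x≈yx-zx x y z ⟩
    y * x - z * x    ≈⟨ x≈y⇒x∙y⁻¹≈ε (trans (*-comm y x) (trans xy≈xz (*-comm x z))) ⟩
    0#               ∎))

  ^ℕ-cong : ∀ n {x y} → x ≈ y → x ^ℕ n ≈ y ^ℕ n
  ^ℕ-cong zero    x≈y = refl
  ^ℕ-cong (suc n) x≈y = *-cong x≈y (^ℕ-cong n x≈y)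

  ^ℕ-homo-* : ∀ x m n → x ^ℕ (m ℕ.+ n) ≈ x ^ℕ m * x ^ℕ n
  ^ℕ-homo-* x zero    n = sym (*-identityˡ _)
  ^ℕ-homo-* x (suc m) n = trans (*-congˡ (^ℕ-homo-* x m n)) (sym (*-assoc _ _ _))

  ^ℕ-distrib-* : ∀ x y n → (x * y) ^ℕ n ≈ x ^ℕ n * y ^ℕ n
  ^ℕ-distrib-* x y zero    = sym (*-identityˡ 1#)
  ^ℕ-distrib-* x y (suc n) = trans (*-congˡ (^ℕ-distrib-* x y n))
    (*-interchange x y _ _)

  1^ℕ : ∀ n → 1# ^ℕ n ≈ 1#
  1^ℕ zero    = refl
  1^ℕ (suc n) = trans (*-identityˡ _) (1^ℕ n)

  ^ℕ-assocʳ : ∀ x m n → (x ^ℕ m) ^ℕ n ≈ x ^ℕ (m ℕ.* n)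
  ^ℕ-assocʳ x zero    n = 1^ℕ n
  ^ℕ-assocʳ x (suc m) n = begin
    (x * x ^ℕ m) ^ℕ n          ≈⟨ ^ℕ-distrib-* x (x ^ℕ m) n ⟩
    x ^ℕ n * (x ^ℕ m) ^ℕ n     ≈⟨ *-congˡ (^ℕ-assocʳ x m n) ⟩
    x ^ℕ n * x ^ℕ (m ℕ.* n)    ≈⟨ ^ℕ-homo-* x n (m ℕ.* n) ⟨
    x ^ℕ (n ℕ.+ m ℕ.* n)       ∎

  ^ℕ-≉0 : ∀ {x} n → ¬ x ≈ 0# → ¬ x ^ℕ n ≈ 0#
  ^ℕ-≉0 zero    x≉0 = 1≉0
  ^ℕ-≉0 (suc n) x≉0 = x*y≉0 x≉0 (^ℕ-≉0 n x≉0)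

  module IntegerPowers {x} (x≉0 : ¬ x ≈ 0#) where

    x*x⁻¹≈1 : x * x ⁻¹ ≈ 1#
    x*x⁻¹≈1 = ⁻¹-inverse x x≉0

    ^ℤ-⊖ : ∀ m n → x ^ℤ (m ℤ.⊖ n) ≈ x ^ℕ m * (x ⁻¹) ^ℕ n
    ^ℤ-⊖ zero    zero    = sym (*-identityˡ _)
    ^ℤ-⊖ (suc m) zero    = sym (*-identityʳ _)
    ^ℤ-⊖ zero    (suc n) = sym (*-identityˡ _)
    ^ℤ-⊖ (suc m) (suc n) = begin
      x ^ℤ (suc m ℤ.⊖ suc n)                   ≡⟨ P.cong (x ^ℤ_) (ℤP.[1+m]⊖[1+n]≡m⊖n m n) ⟩
      x ^ℤ (m ℤ.⊖ n)                           ≈⟨ ^ℤ-⊖ m n ⟩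
      x ^ℕ m * (x ⁻¹) ^ℕ n                     ≈⟨ *-identityˡ _ ⟨
      1# * (x ^ℕ m * (x ⁻¹) ^ℕ n)              ≈⟨ *-congʳ x*x⁻¹≈1 ⟨
      (x * x ⁻¹) * (x ^ℕ m * (x ⁻¹) ^ℕ n)      ≈⟨ *-interchange x (x ⁻¹) _ _ ⟩
      (x * x ^ℕ m) * (x ⁻¹ * (x ⁻¹) ^ℕ n)      ∎

    ^ℤ-homo-* : ∀ s t → x ^ℤ (s ℤ.+ t) ≈ x ^ℤ s * x ^ℤ t
    ^ℤ-homo-* (+ m)    (+ n)    = ^ℕ-homo-* x m n
    ^ℤ-homo-* (+ m)    -[1+ n ] = ^ℤ-⊖ m (suc n)
    ^ℤ-homo-* -[1+ m ] (+ n)    = trans (^ℤ-⊖ n (suc m)) (*-comm _ _)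
    ^ℤ-homo-* -[1+ m ] -[1+ n ] = begin
      x ⁻¹ * (x ⁻¹ * (x ⁻¹) ^ℕ (m ℕ.+ n))   ≡⟨ P.cong ((x ⁻¹) ^ℕ_) (ℕP.+-suc (suc m) n) ⟨
      (x ⁻¹) ^ℕ (suc m ℕ.+ suc n)           ≈⟨ ^ℕ-homo-* (x ⁻¹) (suc m) (suc n) ⟩
      (x ⁻¹) ^ℕ suc m * (x ⁻¹) ^ℕ suc n     ∎

    ^ℤ-^ℕ : ∀ t r → (x ^ℤ t) ^ℕ r ≈ x ^ℤ (t ℤ.* + r)
    ^ℤ-^ℕ t zero    = reflexive (P.cong (x ^ℤ_) (P.sym (ℤP.*-zeroʳ t)))
    ^ℤ-^ℕ t (suc r) = begin
      x ^ℤ t * (x ^ℤ t) ^ℕ r       ≈⟨ *-congˡ (^ℤ-^ℕ t r) ⟩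
      x ^ℤ t * x ^ℤ (t ℤ.* + r)    ≈⟨ ^ℤ-homo-* t (t ℤ.* + r) ⟨
      x ^ℤ (t ℤ.+ t ℤ.* + r)       ≡⟨ P.cong (x ^ℤ_) (ℤP.*-suc t (+ r)) ⟨
      x ^ℤ (t ℤ.* + suc r)         ∎

    ^ℤ-≉0 : ∀ t → ¬ x ^ℤ t ≈ 0#
    ^ℤ-≉0 (+ n)    = ^ℕ-≉0 n x≉0
    ^ℤ-≉0 -[1+ n ] = ^ℕ-≉0 (suc n) (λ x⁻¹≈0 → 1≉0 (trans (sym x*x⁻¹≈1) (trans (*-congˡ x⁻¹≈0) (zeroʳ x))))

    ^ℤ-sumIf : ∀ {k} (b : Fin k → Bool) v → x ^ℤ sumIf b v ≈ Π (tabulate (λ s → if b s then x ^ℤ v s else 1#))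
    ^ℤ-sumIf {zero}  b v = refl
    ^ℤ-sumIf {suc k} b v = trans (^ℤ-homo-* (if b Fin.zero then v Fin.zero else + 0) _)
      (*-cong (head (b Fin.zero)) (^ℤ-sumIf (λ s → b (Fin.suc s)) (λ s → v (Fin.suc s))))
      where
      head : ∀ b₀ → x ^ℤ (if b₀ then v Fin.zero else + 0) ≈ (if b₀ then x ^ℤ v Fin.zero else 1#)
      head true  = refl
      head false = refl

    ^ℤ≈1⇔^ℕ∣∣≈1 : ∀ t → (x ^ℤ t ≈ 1#) ⇔ (x ^ℕ ℤ.∣ t ∣ ≈ 1#)
    ^ℤ≈1⇔^ℕ∣∣≈1 (+ n)    = mk⇔ (λ h → h) (λ h → h)
    ^ℤ≈1⇔^ℕ∣∣≈1 -[1+ n ] = mk⇔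
      (λ h → trans (sym (*-identityˡ _)) (trans (*-congʳ (sym h)) inverse))
      (λ h → trans (sym (*-identityʳ _)) (trans (*-congˡ (sym h)) inverse))
      where
      inverse : (x ⁻¹) ^ℕ suc n * x ^ℕ suc n ≈ 1#
      inverse = trans (sym (^ℕ-distrib-* (x ⁻¹) x (suc n)))
                      (trans (^ℕ-cong (suc n) (trans (*-comm _ _) x*x⁻¹≈1)) (1^ℕ (suc n)))

  Σ-filter-≈0 : ∀ {a p} {A : Set a} {P : A → Set p} (P? : ∀ x → Dec (P x)) (g : A → Carrier) xs →
                (∀ {x} → P x → Σ (map g (filter P? xs)) ≈ 0#) → Σ (map g (filter P? xs)) ≈ 0#
  Σ-filter-≈0 P? g xs ≈0-if-inhabited with filter P? xs | all-filter P? xs | ≈0-if-inhabited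
  ... | []    | _      | _              = refl
  ... | _ ∷ _ | Px ∷ _ | ≈0-if-inhabited = ≈0-if-inhabited Px

  Σ-cong : ∀ {a} {A : Set a} {f g : A → Carrier} xs → (∀ x → f x ≈ g x) → Σ (map f xs) ≈ Σ (map g xs)
  Σ-cong []       f≈g = refl
  Σ-cong (x ∷ xs) f≈g = +-cong (f≈g x) (Σ-cong xs f≈g)

  Σ-≈0 : ∀ {a} {A : Set a} {f : A → Carrier} xs → (∀ x → f x ≈ 0#) → Σ (map f xs) ≈ 0#
  Σ-≈0 []       f≈0 = refl
  Σ-≈0 (x ∷ xs) f≈0 = trans (+-cong (f≈0 x) (Σ-≈0 xs f≈0)) (+-identityˡ 0#)

  Σ-distrib-+ : ∀ {a} {A : Set a} (f g : A → Carrier) xs →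
                Σ (map (λ x → f x + g x) xs) ≈ Σ (map f xs) + Σ (map g xs)
  Σ-distrib-+ f g []       = sym (+-identityˡ _)
  Σ-distrib-+ f g (x ∷ xs) = trans (+-congˡ (Σ-distrib-+ f g xs))
    (+-interchange (f x) (g x) _ _)

  *-distribˡ-Σ : ∀ {a} {A : Set a} y (f : A → Carrier) xs → y * Σ (map f xs) ≈ Σ (map (λ x → y * f x) xs)
  *-distribˡ-Σ y f []       = zeroʳ y
  *-distribˡ-Σ y f (x ∷ xs) = trans (distribˡ y _ _) (+-congˡ (*-distribˡ-Σ y f xs))

  *-distribʳ-Σ : ∀ {a} {A : Set a} y (f : A → Carrier) xs → Σ (map f xs) * y ≈ Σ (map (λ x → f x * y) xs)
  *-distribʳ-Σ y f xs = trans (*-comm _ y) (trans (*-distribˡ-Σ y f xs) (Σ-cong xs (λ x → *-comm y (f x))))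

  Σ-comm : ∀ {a b} {A : Set a} {B : Set b} (h : A → B → Carrier) xs ys →
           Σ (map (λ x → Σ (map (h x) ys)) xs) ≈ Σ (map (λ y → Σ (map (λ x → h x y) xs)) ys)
  Σ-comm h []       ys = sym (Σ-≈0 ys (λ _ → refl))
  Σ-comm h (x ∷ xs) ys = trans (+-congˡ (Σ-comm h xs ys)) (sym (Σ-distrib-+ (h x) _ ys))

  Σ-concatMap-pair : ∀ {a b} {A : Set a} {B : Set b} (g : A → Carrier) (u v : B → A) ys →
                     Σ (map g (concatMap (λ y → u y ∷ v y ∷ []) ys)) ≈ Σ (map (λ y → g (u y) + g (v y)) ys)
  Σ-concatMap-pair g u v []       = refl
  Σ-concatMap-pair g u v (y ∷ ys) = trans (sym (+-assoc _ _ _)) (+-congˡ (Σ-concatMap-pair g u v ys))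

  Π-cong : ∀ {k} {h h′ : Fin k → Carrier} → (∀ s → h s ≈ h′ s) → Π (tabulate h) ≈ Π (tabulate h′)
  Π-cong {zero}  h≈h′ = refl
  Π-cong {suc k} h≈h′ = *-cong (h≈h′ Fin.zero) (Π-cong (λ s → h≈h′ (Fin.suc s)))

  Π-distrib-* : ∀ {k} (h h′ : Fin k → Carrier) → Π (tabulate (λ s → h s * h′ s)) ≈ Π (tabulate h) * Π (tabulate h′)
  Π-distrib-* {zero}  h h′ = sym (*-identityˡ 1#)
  Π-distrib-* {suc k} h h′ = trans (*-congˡ (Π-distrib-* (λ s → h (Fin.suc s)) (λ s → h′ (Fin.suc s))))
    (*-interchange (h Fin.zero) (h′ Fin.zero) _ _)

  Π-≈0 : ∀ {k} (h : Fin k → Carrier) s → h s ≈ 0# → Π (tabulate h) ≈ 0#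
  Π-≈0 h Fin.zero    hs≈0 = trans (*-congʳ hs≈0) (zeroˡ _)
  Π-≈0 h (Fin.suc s) hs≈0 = trans (*-congˡ (Π-≈0 (λ s → h (Fin.suc s)) s hs≈0)) (zeroʳ _)

  Π-≉0 : ∀ {k} (h : Fin k → Carrier) → (∀ s → ¬ h s ≈ 0#) → ¬ Π (tabulate h) ≈ 0#
  Π-≉0 {zero}  h h≉0 = 1≉0
  Π-≉0 {suc k} h h≉0 = x*y≉0 (h≉0 Fin.zero) (Π-≉0 (λ s → h (Fin.suc s)) (λ s → h≉0 (Fin.suc s)))

  Σ-allSubsets-Π : ∀ k (φ : Fin k → Bool → Carrier) →
                   Σ (map (λ J → Π (tabulate (λ s → φ s (lookup J s)))) (allSubsets k))
                   ≈ Π (tabulate (λ s → φ s false + φ s true))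
  Σ-allSubsets-Π zero    φ = +-identityʳ 1#
  Σ-allSubsets-Π (suc k) φ = begin
    Σ (map term (concatMap (λ J → (false ∷ J) ∷ (true ∷ J) ∷ []) (allSubsets k)))
      ≈⟨ Σ-concatMap-pair term (false ∷_) (true ∷_) (allSubsets k) ⟩
    Σ (map (λ J → φ₀ false * rest J + φ₀ true * rest J) (allSubsets k))
      ≈⟨ Σ-cong (allSubsets k) (λ J → sym (distribʳ (rest J) _ _)) ⟩
    Σ (map (λ J → (φ₀ false + φ₀ true) * rest J) (allSubsets k))
      ≈⟨ *-distribˡ-Σ _ rest (allSubsets k) ⟨
    (φ₀ false + φ₀ true) * Σ (map rest (allSubsets k))
      ≈⟨ *-congˡ (Σ-allSubsets-Π k (λ s → φ (Fin.suc s))) ⟩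
    (φ₀ false + φ₀ true) * Π (tabulate (λ s → φ (Fin.suc s) false + φ (Fin.suc s) true)) ∎
    where
    φ₀ : Bool → Carrier
    φ₀ = φ Fin.zero
    term : Vec Bool (suc k) → Carrier
    term J = Π (tabulate (λ s → φ s (lookup J s)))
    rest : Vec Bool k → Carrier
    rest J = Π (tabulate (λ s → φ (Fin.suc s) (lookup J s)))

  sign-card : ∀ {k} (J : Vec Bool k) → sign (card J) ≈ Π (tabulate (λ s → if lookup J s then - 1# else 1#))
  sign-card []          = refl
  sign-card (true ∷ J)  = *-congˡ (sign-card J)
  sign-card (false ∷ J) = trans (sign-card J) (sym (*-identityˡ _))

  -- Linear forms on polynomials in k variables

  module _ {k : ℕ} where

    _~_ : Exponent k → Exponent k → Set
    e ~ e′ = ∀ s → e s ≡ e′ s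

    Respects~ : (Exponent k → Carrier) → Set ℓ
    Respects~ g = ∀ {e e′} → e ~ e′ → g e ≈ g e′

    linearExtension : (Exponent k → Carrier) → Poly k → Carrier
    linearExtension g f = Σ (map (λ t → proj₁ t * g (proj₂ t)) f)

    vanishAt : Exponent k → (Exponent k → Carrier) → Exponent k → Carrier
    vanishAt e₀ g e = if ⌊ sameExp? e e₀ ⌋ then 0# else g e

    vanishAt-respects~ : ∀ e₀ {g} → Respects~ g → Respects~ (vanishAt e₀ g)
    vanishAt-respects~ e₀ {g} g-resp {e} {e′} e~e′ with sameExp? e e₀ | sameExp? e′ e₀
    ... | yes _    | yes _    = refl
    ... | yes e~e₀ | no e′≁e₀ = ⊥-elim (e′≁e₀ (λ s → P.trans (P.sym (e~e′ s)) (e~e₀ s)))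
    ... | no e≁e₀  | yes e′~e₀ = ⊥-elim (e≁e₀ (λ s → P.trans (e~e′ s) (e′~e₀ s)))
    ... | no _     | no _     = g-resp e~e′

    linearExtension-split : ∀ e₀ {g} → Respects~ g → ∀ f →
                            linearExtension g f ≈ linearExtension (vanishAt e₀ g) f + coeff f e₀ * g e₀
    linearExtension-split e₀ g-resp [] = sym (trans (+-identityˡ _) (zeroˡ _))
    linearExtension-split e₀ {g} g-resp ((a , e) ∷ f) with sameExp? e e₀
    ... | yes e~e₀ = begin
      a * g e + linearExtension g f
        ≈⟨ +-cong (*-congˡ (g-resp e~e₀)) (linearExtension-split e₀ g-resp f) ⟩
      a * g e₀ + (L + coeff f e₀ * g e₀)
        ≈⟨ solve 4 (λ a g L c → a :* g :+ (L :+ c :* g) := L :+ (a :+ c) :* g) refl a (g e₀) L (coeff f e₀) ⟩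
      L + (a + coeff f e₀) * g e₀
        ≈⟨ +-congʳ (trans (+-congʳ (zeroʳ a)) (+-identityˡ _)) ⟨
      (a * 0# + L) + (a + coeff f e₀) * g e₀ ∎
      where L = linearExtension (vanishAt e₀ g) f
    ... | no _ = begin
      a * g e + linearExtension g f
        ≈⟨ +-congˡ (linearExtension-split e₀ g-resp f) ⟩
      a * g e + (L + coeff f e₀ * g e₀)
        ≈⟨ +-assoc _ _ _ ⟨
      (a * g e + L) + coeff f e₀ * g e₀
        ≈⟨ +-congˡ (*-congʳ (+-identityˡ _)) ⟨
      (a * g e + L) + (0# + coeff f e₀) * g e₀ ∎
      where L = linearExtension (vanishAt e₀ g) f

    -- The hypothesis is on the collected coefficients, so terms of f with
    -- equal exponents must be gathered before they can be discarded.
    linearExtension-≈0 : ∀ {g} → Respects~ g → ∀ f → (∀ e → coeff f e * g e ≈ 0#) → linearExtension g f ≈ 0#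
    linearExtension-≈0 g-resp [] _ = refl
    linearExtension-≈0 {g} g-resp ((a , e) ∷ f) coeffs≈0 = begin
      a * g e + linearExtension g f
        ≈⟨ +-congˡ (linearExtension-split e g-resp f) ⟩
      a * g e + (linearExtension (vanishAt e g) f + coeff f e * g e)
        ≈⟨ +-congˡ (+-congʳ (linearExtension-≈0 (vanishAt-respects~ e g-resp) f rest≈0)) ⟩
      a * g e + (0# + coeff f e * g e)
        ≈⟨ trans (+-congˡ (+-identityˡ _)) (sym (distribʳ _ _ _)) ⟩
      (a + coeff f e) * g e
        ≈⟨ *-congʳ (+-congʳ (head-coeff a e)) ⟩
      coeff ((a , e) ∷ f) e * g e
        ≈⟨ coeffs≈0 e ⟩
      0# ∎
      where
      head-coeff : ∀ a e → a ≈ (if ⌊ sameExp? e e ⌋ then a else 0#)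
      head-coeff a e with sameExp? e e
      ... | yes _ = refl
      ... | no e≁e = ⊥-elim (e≁e (λ _ → P.refl))
      rest≈0 : ∀ e′ → coeff f e′ * vanishAt e g e′ ≈ 0#
      rest≈0 e′ with sameExp? e′ e | sameExp? e e′ | coeffs≈0 e′
      ... | yes _     | _       | _ = zeroʳ _
      ... | no e′≁e   | yes e~e′ | _ = ⊥-elim (e′≁e (λ s → P.sym (e~e′ s)))
      ... | no _      | no _    | c≈0 = trans (*-congʳ (sym (+-identityˡ _))) c≈0

    linearExtension-single : ∀ {g} → Respects~ g → ∀ f e₀ → (∀ e → ¬ e ~ e₀ → coeff f e * g e ≈ 0#) →
                             linearExtension g f ≈ coeff f e₀ * g e₀
    linearExtension-single {g} g-resp f e₀ others≈0 = begin
      linearExtension g f                                          ≈⟨ linearExtension-split e₀ g-resp f ⟩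
      linearExtension (vanishAt e₀ g) f + coeff f e₀ * g e₀        ≈⟨ +-congʳ (linearExtension-≈0 (vanishAt-respects~ e₀ g-resp) f cut≈0) ⟩
      0# + coeff f e₀ * g e₀                                       ≈⟨ +-identityˡ _ ⟩
      coeff f e₀ * g e₀                                            ∎
      where
      cut≈0 : ∀ e → coeff f e * vanishAt e₀ g e ≈ 0#
      cut≈0 e with sameExp? e e₀
      ... | yes _   = zeroʳ _
      ... | no e≁e₀ = others≈0 e e≁e₀

  -- Polynomials in one variable

  sumBelow : ℕ → (ℕ → Carrier) → Carrier
  sumBelow zero    g = 0#
  sumBelow (suc n) g = sumBelow n g + g n

  sumBelow-cong : ∀ n {g h} → (∀ r → r ℕ.< n → g r ≈ h r) → sumBelow n g ≈ sumBelow n h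
  sumBelow-cong zero    g≈h = refl
  sumBelow-cong (suc n) g≈h = +-cong (sumBelow-cong n (λ r r<n → g≈h r (ℕP.m<n⇒m<1+n r<n))) (g≈h n ℕP.≤-refl)

  sumBelow-≈0 : ∀ n {g} → (∀ r → r ℕ.< n → g r ≈ 0#) → sumBelow n g ≈ 0#
  sumBelow-≈0 n {g} g≈0 = trans (sumBelow-cong n g≈0) (lemma n)
    where
    lemma : ∀ n → sumBelow n (λ _ → 0#) ≈ 0#
    lemma zero    = refl
    lemma (suc n) = trans (+-identityʳ _) (lemma n)

  sumBelow-distrib-+ : ∀ n (g h : ℕ → Carrier) → sumBelow n (λ r → g r + h r) ≈ sumBelow n g + sumBelow n h
  sumBelow-distrib-+ zero    g h = sym (+-identityˡ 0#)
  sumBelow-distrib-+ (suc n) g h = trans (+-congʳ (sumBelow-distrib-+ n g h))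
    (+-interchange _ _ (g n) (h n))

  *-distribˡ-sumBelow : ∀ n y (g : ℕ → Carrier) → y * sumBelow n g ≈ sumBelow n (λ r → y * g r)
  *-distribˡ-sumBelow zero    y g = zeroʳ y
  *-distribˡ-sumBelow (suc n) y g = trans (distribˡ y _ _) (+-congʳ (*-distribˡ-sumBelow n y g))

  sumBelow-δ : ∀ n a (v : ℕ → Carrier) → a ℕ.< n → sumBelow n (λ r → if ⌊ a ℕ.≟ r ⌋ then v r else 0#) ≈ v a
  sumBelow-δ (suc n) a v a<1+n with ℕP.m<1+n⇒m<n∨m≡n a<1+n
  ... | inj₁ a<n = trans (+-cong (sumBelow-δ n a v a<n) off) (+-identityʳ _)
    where
    off : (if ⌊ a ℕ.≟ n ⌋ then v n else 0#) ≈ 0#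
    off with a ℕ.≟ n
    ... | yes a≡n = ⊥-elim (ℕP.<⇒≢ a<n a≡n)
    ... | no _    = refl
  ... | inj₂ P.refl = trans (+-cong (sumBelow-≈0 a off) on) (+-identityˡ _)
    where
    off : ∀ r → r ℕ.< a → (if ⌊ a ℕ.≟ r ⌋ then v r else 0#) ≈ 0#
    off r r<a with a ℕ.≟ r
    ... | yes a≡r = ⊥-elim (ℕP.<⇒≢ r<a (P.sym a≡r))
    ... | no _    = refl
    on : (if ⌊ a ℕ.≟ a ⌋ then v a else 0#) ≈ v a
    on with a ℕ.≟ a
    ... | yes _   = refl
    ... | no a≢a  = ⊥-elim (a≢a P.refl)

  polynomial : (ℕ → Carrier) → ℕ → Carrier → Carrier
  polynomial c L x = sumBelow L (λ r → c r * x ^ℕ r)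

  polynomial-≈0 : ∀ L x {c} → (∀ r → c r ≈ 0#) → polynomial c L x ≈ 0#
  polynomial-≈0 L x c≈0 = sumBelow-≈0 L (λ r _ → trans (*-congʳ (c≈0 r)) (zeroˡ _))

  Σ-collect-powers : ∀ {a} {A : Set a} (deg : A → ℕ) (t : A → Carrier) L x xs → (∀ J → deg J ℕ.< L) →
                     Σ (map (λ J → x ^ℕ deg J * t J) xs)
                     ≈ polynomial (λ r → Σ (map t (filter (λ J → deg J ℕ.≟ r) xs))) L x
  Σ-collect-powers deg t L x []       deg<L = sym (polynomial-≈0 L x (λ _ → refl))
  Σ-collect-powers deg t L x (J ∷ xs) deg<L = begin
    x ^ℕ deg J * t J + Σ (map (λ J → x ^ℕ deg J * t J) xs)
      ≈⟨ +-cong (trans (*-comm _ _) (sym (sumBelow-δ L (deg J) (λ r → t J * x ^ℕ r) (deg<L J))))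
                (Σ-collect-powers deg t L x xs deg<L) ⟩
    sumBelow L (λ r → (if ⌊ deg J ℕ.≟ r ⌋ then t J * x ^ℕ r else 0#)) + polynomial tail L x
      ≈⟨ sumBelow-distrib-+ L _ _ ⟨
    sumBelow L (λ r → (if ⌊ deg J ℕ.≟ r ⌋ then t J * x ^ℕ r else 0#) + tail r * x ^ℕ r)
      ≈⟨ sumBelow-cong L (λ r _ → step r) ⟩
    polynomial (λ r → Σ (map t (filter (λ J → deg J ℕ.≟ r) (J ∷ xs)))) L x ∎
    where
    tail : ℕ → Carrier
    tail r = Σ (map t (filter (λ J → deg J ℕ.≟ r) xs))
    step : ∀ r → (if ⌊ deg J ℕ.≟ r ⌋ then t J * x ^ℕ r else 0#) + tail r * x ^ℕ r
                 ≈ Σ (map t (filter (λ J → deg J ℕ.≟ r) (J ∷ xs))) * x ^ℕ r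
    step r with deg J ℕ.≟ r
    ... | yes J∈r rewrite LP.filter-accept (λ J → deg J ℕ.≟ r) {J} {xs} J∈r = sym (distribʳ _ _ _)
    ... | no J∉r  rewrite LP.filter-reject (λ J → deg J ℕ.≟ r) {J} {xs} J∉r = +-identityˡ _

  module RootOfUnity {ζ : Carrier} {N : ℕ} (ord : HasOrder ζ N) where

    0<N : 0 ℕ.< N
    0<N = proj₁ ord

    ζ^N≈1 : ζ ^ℕ N ≈ 1#
    ζ^N≈1 = proj₁ (proj₂ ord)

    minimal : ∀ j → 0 ℕ.< j → j ℕ.< N → ¬ ζ ^ℕ j ≈ 1#
    minimal = proj₂ (proj₂ ord)

    instance
      N≢0 : ℕ.NonZero N
      N≢0 = ℕ.>-nonZero 0<N

    ζ≉0 : ¬ ζ ≈ 0#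
    ζ≉0 = root≉0 N 0<N ζ^N≈1
      where
      root≉0 : ∀ n → 0 ℕ.< n → ζ ^ℕ n ≈ 1# → ¬ ζ ≈ 0#
      root≉0 (suc n) _ ζ^n≈1 ζ≈0 = 1≉0 (trans (sym ζ^n≈1) (trans (*-congʳ ζ≈0) (zeroˡ _)))

    open IntegerPowers ζ≉0 public

    ∣⇒^ℕ≈1 : ∀ {n} → N ℕD.∣ n → ζ ^ℕ n ≈ 1#
    ∣⇒^ℕ≈1 (ℕD.divides q P.refl) = begin
      ζ ^ℕ (q ℕ.* N)    ≡⟨ P.cong (ζ ^ℕ_) (ℕP.*-comm q N) ⟩
      ζ ^ℕ (N ℕ.* q)    ≈⟨ ^ℕ-assocʳ ζ N q ⟨
      (ζ ^ℕ N) ^ℕ q     ≈⟨ ^ℕ-cong q ζ^N≈1 ⟩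
      1# ^ℕ q           ≈⟨ 1^ℕ q ⟩
      1#                ∎

    ^ℕ≈1⇒∣ : ∀ n → ζ ^ℕ n ≈ 1# → N ℕD.∣ n
    ^ℕ≈1⇒∣ n ζ^n≈1 = ℕD.m%n≡0⇒n∣m n N (residue≡0 (n ℕ.% N) (ℕDM.m%n<n n N) (begin
      ζ ^ℕ (n ℕ.% N)                          ≈⟨ *-identityʳ _ ⟨
      ζ ^ℕ (n ℕ.% N) * 1#                     ≈⟨ *-congˡ (∣⇒^ℕ≈1 (ℕD.divides (n ℕ./ N) P.refl)) ⟨
      ζ ^ℕ (n ℕ.% N) * ζ ^ℕ (n ℕ./ N ℕ.* N)   ≈⟨ ^ℕ-homo-* ζ (n ℕ.% N) _ ⟨
      ζ ^ℕ (n ℕ.% N ℕ.+ n ℕ./ N ℕ.* N)        ≡⟨ P.cong (ζ ^ℕ_) (ℕDM.m≡m%n+[m/n]*n n N) ⟨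
      ζ ^ℕ n                                  ≈⟨ ζ^n≈1 ⟩
      1#                                      ∎))
      where
      residue≡0 : ∀ r → r ℕ.< N → ζ ^ℕ r ≈ 1# → r ≡ 0
      residue≡0 zero    _   _       = P.refl
      residue≡0 (suc r) r<N ζ^r≈1 = ⊥-elim (minimal (suc r) (ℕ.s≤s ℕ.z≤n) r<N ζ^r≈1)

    ^ℤ≈1⇔∣ : ∀ t → (ζ ^ℤ t ≈ 1#) ⇔ (N ℕD.∣ ℤ.∣ t ∣)
    ^ℤ≈1⇔∣ t = mk⇔ (λ h → ^ℕ≈1⇒∣ ℤ.∣ t ∣ (Equivalence.to (^ℤ≈1⇔^ℕ∣∣≈1 t) h))
                   (λ N∣t → Equivalence.from (^ℤ≈1⇔^ℕ∣∣≈1 t) (∣⇒^ℕ≈1 N∣t))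

    ^ℕ-distinct : ∀ {i j} → i ℕ.< j → j ℕ.< N → ¬ ζ ^ℕ i - ζ ^ℕ j ≈ 0#
    ^ℕ-distinct {i} {j} i<j j<N ζ^i-ζ^j≈0 =
      minimal (j ℕ.∸ i) (ℕP.m<n⇒0<n∸m i<j) (ℕP.≤-<-trans (ℕP.m∸n≤m j i) j<N)
        (sym (*-cancelˡ-≉0 (^ℕ-≉0 i ζ≉0) (begin
          ζ ^ℕ i * 1#                 ≈⟨ *-identityʳ _ ⟩
          ζ ^ℕ i                      ≈⟨ x∙y⁻¹≈ε⇒x≈y _ _ ζ^i-ζ^j≈0 ⟩
          ζ ^ℕ j                      ≡⟨ P.cong (ζ ^ℕ_) (ℕP.m+[n∸m]≡n (ℕP.<⇒≤ i<j)) ⟨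
          ζ ^ℕ (i ℕ.+ (j ℕ.∸ i))      ≈⟨ ^ℕ-homo-* ζ i (j ℕ.∸ i) ⟩
          ζ ^ℕ i * ζ ^ℕ (j ℕ.∸ i)     ∎)))

    polynomial-shift : ∀ c L x → polynomial (λ r → c r * (ζ ^ℕ r - ζ ^ℕ L)) L x + ζ ^ℕ L * polynomial c (suc L) x
                                 ≈ polynomial c (suc L) (ζ * x)
    polynomial-shift c L x = begin
      Q + ζ ^ℕ L * (P₀ + c L * x ^ℕ L)
        ≈⟨ solve 5 (λ q z p cL xL → q :+ z :* (p :+ cL :* xL) := (q :+ z :* p) :+ cL :* (z :* xL))
                   refl Q (ζ ^ℕ L) P₀ (c L) (x ^ℕ L) ⟩
      (Q + ζ ^ℕ L * P₀) + c L * (ζ ^ℕ L * x ^ℕ L)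
        ≈⟨ +-cong (+-congˡ (*-distribˡ-sumBelow L (ζ ^ℕ L) _)) (*-congˡ (sym (^ℕ-distrib-* ζ x L))) ⟩
      (Q + sumBelow L (λ r → ζ ^ℕ L * (c r * x ^ℕ r))) + c L * (ζ * x) ^ℕ L
        ≈⟨ +-congʳ (trans (sym (sumBelow-distrib-+ L _ _)) (sumBelow-cong L (λ r _ → term r))) ⟩
      polynomial c L (ζ * x) + c L * (ζ * x) ^ℕ L ∎
      where
      Q  = polynomial (λ r → c r * (ζ ^ℕ r - ζ ^ℕ L)) L x
      P₀ = polynomial c L x
      term : ∀ r → c r * (ζ ^ℕ r - ζ ^ℕ L) * x ^ℕ r + ζ ^ℕ L * (c r * x ^ℕ r) ≈ c r * (ζ * x) ^ℕ r
      term r = begin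
        c r * (ζ ^ℕ r - ζ ^ℕ L) * x ^ℕ r + ζ ^ℕ L * (c r * x ^ℕ r)
          ≈⟨ solve 4 (λ cr d z xr → cr :* d :* xr :+ z :* (cr :* xr) := cr :* (d :+ z) :* xr)
                     refl (c r) (ζ ^ℕ r - ζ ^ℕ L) (ζ ^ℕ L) (x ^ℕ r) ⟩
        c r * ((ζ ^ℕ r - ζ ^ℕ L) + ζ ^ℕ L) * x ^ℕ r
          ≈⟨ *-congʳ (*-congˡ (trans (+-assoc _ _ _) (trans (+-congˡ (-‿inverseˡ _)) (+-identityʳ _)))) ⟩
        c r * ζ ^ℕ r * x ^ℕ r
          ≈⟨ trans (*-assoc _ _ _) (*-congˡ (sym (^ℕ-distrib-* ζ x r))) ⟩
        c r * (ζ * x) ^ℕ r ∎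

    -- Vandermonde: P(ζ x) - ζ^L P(x) has the coefficients c r (ζ^r - ζ^L) below
    -- degree L and vanishes at ζ^j for j < L, so induction applies to it; then
    -- c L ≈ 0 follows from P(1) ≈ 0.
    vanishing-coefficients : ∀ L → L ℕ.≤ N → ∀ c → (∀ j → j ℕ.< L → polynomial c L (ζ ^ℕ j) ≈ 0#) →
                             ∀ r → r ℕ.< L → c r ≈ 0#
    vanishing-coefficients (suc L) L<N c roots = below-suc
      where
      lower : ∀ r → r ℕ.< L → c r ≈ 0#
      lower r r<L = x*y≈0⇒x≈0 (^ℕ-distinct r<L L<N) (vanishing-coefficients L (ℕP.<⇒≤ L<N) _ quotient-roots r r<L)
        where
        quotient-roots : ∀ j → j ℕ.< L → polynomial (λ r → c r * (ζ ^ℕ r - ζ ^ℕ L)) L (ζ ^ℕ j) ≈ 0#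
        quotient-roots j j<L = begin
          Q                                            ≈⟨ +-identityʳ Q ⟨
          Q + 0#                                       ≈⟨ +-congˡ (zeroʳ (ζ ^ℕ L)) ⟨
          Q + ζ ^ℕ L * 0#                              ≈⟨ +-congˡ (*-congˡ (roots j (ℕP.m<n⇒m<1+n j<L))) ⟨
          Q + ζ ^ℕ L * polynomial c (suc L) (ζ ^ℕ j)   ≈⟨ polynomial-shift c L (ζ ^ℕ j) ⟩
          polynomial c (suc L) (ζ ^ℕ suc j)            ≈⟨ roots (suc j) (ℕ.s≤s j<L) ⟩
          0#                                           ∎
          where Q = polynomial (λ r → c r * (ζ ^ℕ r - ζ ^ℕ L)) L (ζ ^ℕ j)
      top : c L ≈ 0#
      top = begin
        c L                                ≈⟨ +-identityˡ _ ⟨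
        0# + c L                           ≈⟨ +-cong (sym (sumBelow-≈0 L (λ r r<L → trans (*-congʳ (lower r r<L)) (zeroˡ _))))
                                                     (sym (trans (*-congˡ (1^ℕ L)) (*-identityʳ _))) ⟩
        polynomial c (suc L) (ζ ^ℕ 0)      ≈⟨ roots 0 (ℕ.s≤s ℕ.z≤n) ⟩
        0#                                 ∎
      below-suc : ∀ r → r ℕ.< suc L → c r ≈ 0#
      below-suc r r<1+L with ℕP.m<1+n⇒m<n∨m≡n r<1+L
      ... | inj₁ r<L    = lower r r<L
      ... | inj₂ P.refl = top

module ClassSums {c ℓ : Level} (F : Field c ℓ) {k : ℕ} (A : System k) (m : Fin k → ℤ)
                 {ζ : Field.Carrier F} (ord : FieldOps.HasOrder F ζ (N A)) (f : FieldOps.Poly F k) where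
  open Field F
  open FieldOps F
  open FieldProperties F
  open RootOfUnity ord
  open System A
  open import Algebra.Properties.Ring ring using (-1*x≈-x; -‿distribʳ-*; -0#≈0#; -‿involutive; x∙y⁻¹≈ε⇒x≈y)
  open import Relation.Binary.Reasoning.Setoid setoid

  n∣N : ∀ s → n s ℕD.∣ N A
  n∣N s = P.subst (n s ℕD.∣_) (P.cong (foldr lcm 1) (P.sym (map-allFin n))) (∣-lcm-foldr n s)

  d : Fin k → ℕ
  d s = (N A ℕ./ n s) {{n-pos s}}

  n*d≡N : ∀ s → n s ℕ.* d s ≡ N A
  n*d≡N s = P.trans (ℕP.*-comm (n s) (d s)) (ℕDM.m/n*n≡m {{n-pos s}} (n∣N s))

  d≢0 : ∀ s → ℕ.NonZero (d s)
  d≢0 s = ℕ.≢-nonZero (λ d≡0 → ℕ.≢-nonZero⁻¹ (N A)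
    (P.trans (P.sym (n*d≡N s)) (P.trans (P.cong (n s ℕ.*_) d≡0) (ℕP.*-zeroʳ (n s)))))

  R : Vec Bool k → ℤ
  R J = sumIf (lookup J) (λ s → m s ℤ.* + d s)

  ρ : Vec Bool k → ℕ
  ρ J = R J ℤDM.%ℕ N A

  ρ<N : ∀ J → ρ J ℕ.< N A
  ρ<N J = ℤDM.n%ℕd<d (R J) (N A)

  frac-ratSum : ∀ J → frac (ratSum A m J) ≡ + ρ J ℚ./ N A
  frac-ratSum J = FractionalPart.frac-≃ (ratSum A m J) (R J) (N A)
    (P.subst (λ q → ℚ.toℚᵘ q ℚᵘ.≃ (R J ℚᵘ./ N A))
             (P.cong (foldr ℚ._+_ 0ℚ) (P.sym (map-allFin (λ s → if lookup J s then m/n s else 0ℚ))))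
      (FractionalPart.Σ-/ (N A) (lookup J) (λ s → m s ℤ.* + d s) m/n
        (λ s → FractionalPart./-scale (N A) (m s) (n s) {{n-pos s}} (d s) (n*d≡N s))))
    where
    m/n : Fin k → ℚ
    m/n s = (m s ℚ./ n s) {{n-pos s}}

  same-frac⇒same-ρ : ∀ J J′ → frac (ratSum A m J) ≡ frac (ratSum A m J′) → ρ J ≡ ρ J′
  same-frac⇒same-ρ J J′ eq = FractionalPart.+/-injective (N A) (ρ J) (ρ J′)
    (P.trans (P.sym (frac-ratSum J)) (P.trans eq (frac-ratSum J′)))

  same-ρ⇒same-frac : ∀ J J′ → ρ J ≡ ρ J′ → frac (ratSum A m J) ≡ frac (ratSum A m J′)
  same-ρ⇒same-frac J J′ eq = P.trans (frac-ratSum J) (P.trans (P.cong (λ r → + r ℚ./ N A) eq) (P.sym (frac-ratSum J′)))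

  χ : Vec Bool k → Fin k → Carrier
  χ J s = if lookup J s then 1# else 0#

  term : Vec Bool k → Carrier
  term J = sign (card J) * eval f (χ J) * ζ ^ℤ expo A m J

  classSum : ℕ → Carrier
  classSum r = Σ (map term (filter (λ J → ρ J ℕ.≟ r) (allSubsets k)))

  ψ≡classSum : ∀ θ J → frac (ratSum A m J) ≡ θ → ψ F A m f ζ θ ≡ classSum (ρ J)
  ψ≡classSum θ J frac≡θ = P.cong (λ Js → Σ (map term Js)) (LP.filter-≐ _ _
    ((λ {J′} frac≡θ′ → same-frac⇒same-ρ J′ J (P.trans frac≡θ′ (P.sym frac≡θ)))
    , (λ {J′} ρ≡ρ → P.trans (same-ρ⇒same-frac J′ J ρ≡ρ) frac≡θ))
    (allSubsets k))

  classSums≈0⇒ψ≈0 : (∀ r → r ℕ.< N A → classSum r ≈ 0#) → ∀ θ → ψ F A m f ζ θ ≈ 0#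
  classSums≈0⇒ψ≈0 classSum≈0 θ = Σ-filter-≈0 _ term (allSubsets k)
    (λ {J} frac≡θ → trans (reflexive (ψ≡classSum θ J frac≡θ)) (classSum≈0 (ρ J) (ρ<N J)))

  ψ≈0⇒classSums≈0 : (∀ θ → 0ℚ ≤ θ → θ < 1ℚ → ψ F A m f ζ θ ≈ 0#) → ∀ r → classSum r ≈ 0#
  ψ≈0⇒classSums≈0 ψ≈0 r = Σ-filter-≈0 _ term (allSubsets k) (λ {J} ρ≡r →
    P.subst (λ r → classSum r ≈ 0#) ρ≡r
      (trans (reflexive (P.sym (ψ≡classSum (frac (ratSum A m J)) J P.refl))) (ψ≈0 _ (0≤θ J) (θ<1 J))))
    where
    0≤θ : ∀ J → 0ℚ ≤ frac (ratSum A m J)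
    0≤θ J = P.subst (0ℚ ≤_) (P.sym (frac-ratSum J)) (FractionalPart.0≤+/ (N A) (ρ J))
    θ<1 : ∀ J → frac (ratSum A m J) < 1ℚ
    θ<1 J = P.subst (_< 1ℚ) (P.sym (frac-ratSum J)) (FractionalPart.+/<1 (N A) (ρ J) (ρ<N J))

  twistExponent : ℤ → Fin k → ℤ
  twistExponent z s = (a s ℤ.- z) ℤ.* m s ℤ.* + d s

  twist : ℤ → Fin k → Carrier
  twist z s = ζ ^ℤ twistExponent z s

  localFactor : ℤ → Exponent k → Fin k → Bool → Carrier
  localFactor z e s b = (if b then 1# else 0#) ^ℕ e s * (if b then - twist z s else 1#)

  monomialValue : ℤ → Exponent k → Carrier
  monomialValue z e = Π (tabulate (λ s → localFactor z e s false + localFactor z e s true))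

  monomialValue-respects~ : ∀ z → Respects~ (monomialValue z)
  monomialValue-respects~ z e~e′ = Π-cong (λ s → reflexive (P.cong (λ t → 0# ^ℕ t * 1# + 1# ^ℕ t * - twist z s) (e~e′ s)))

  ^ρ≈^R : ∀ w J → (ζ ^ℤ w) ^ℕ ρ J ≈ ζ ^ℤ (w ℤ.* R J)
  ^ρ≈^R w J = begin
    (ζ ^ℤ w) ^ℕ ρ J                               ≈⟨ ^ℤ-^ℕ w (ρ J) ⟩
    ζ ^ℤ (w ℤ.* + ρ J)                            ≈⟨ *-identityʳ _ ⟨
    ζ ^ℤ (w ℤ.* + ρ J) * 1#                       ≈⟨ *-congˡ (Equivalence.from (^ℤ≈1⇔∣ (w ℤ.* q ℤ.* + N A)) N∣wqN) ⟨
    ζ ^ℤ (w ℤ.* + ρ J) * ζ ^ℤ (w ℤ.* q ℤ.* + N A)  ≈⟨ ^ℤ-homo-* (w ℤ.* + ρ J) (w ℤ.* q ℤ.* + N A) ⟨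
    ζ ^ℤ (w ℤ.* + ρ J ℤ.+ w ℤ.* q ℤ.* + N A)       ≡⟨ P.cong (ζ ^ℤ_) exponents ⟩
    ζ ^ℤ (w ℤ.* R J)                              ∎
    where
    q = R J ℤDM./ℕ N A
    N∣wqN : N A ℕD.∣ ∣ w ℤ.* q ℤ.* + N A ∣
    N∣wqN = P.subst (N A ℕD.∣_) (P.sym (ℤP.abs-* (w ℤ.* q) (+ N A))) (ℕD.n∣m*n ∣ w ℤ.* q ∣)
    exponents : w ℤ.* + ρ J ℤ.+ w ℤ.* q ℤ.* + N A ≡ w ℤ.* R J
    exponents = P.trans (solve 4 (λ w r q n → w :* r :+ w :* q :* n := w :* (r :+ q :* n)) P.refl w (+ ρ J) q (+ N A))
                        (P.cong (w ℤ.*_) (P.sym (ℤDM.a≡a%ℕn+[a/ℕn]*n (R J) (N A))))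
      where open +-*-Solver

  signed-twist : ∀ z s → ζ ^ℤ (ℤ.- z ℤ.* (m s ℤ.* + d s)) * (- 1# * ζ ^ℤ (a s ℤ.* m s ℤ.* + d s)) ≈ - twist z s
  signed-twist z s = begin
    ζ ^ℤ u * (- 1# * ζ ^ℤ v)   ≈⟨ *-congˡ (-1*x≈-x _) ⟩
    ζ ^ℤ u * - ζ ^ℤ v          ≈⟨ -‿distribʳ-* _ _ ⟨
    - (ζ ^ℤ u * ζ ^ℤ v)        ≈⟨ -‿cong (^ℤ-homo-* u v) ⟨
    - ζ ^ℤ (u ℤ.+ v)           ≡⟨ P.cong (λ t → - ζ ^ℤ t) exponents ⟩
    - twist z s                ∎
    where
    open +-*-Solver
    u = ℤ.- z ℤ.* (m s ℤ.* + d s)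
    v = a s ℤ.* m s ℤ.* + d s
    exponents : u ℤ.+ v ≡ twistExponent z s
    exponents = solve 4 (λ z m d a → (:- z) :* (m :* d) :+ a :* m :* d := (a :- z) :* m :* d) P.refl z (m s) (+ d s) (a s)

  weight-factorises : ∀ z J → (ζ ^ℤ (ℤ.- z)) ^ℕ ρ J * (sign (card J) * ζ ^ℤ expo A m J)
                              ≈ Π (tabulate (λ s → if lookup J s then - twist z s else 1#))
  weight-factorises z J = begin
    (ζ ^ℤ (ℤ.- z)) ^ℕ ρ J * (sign (card J) * ζ ^ℤ expo A m J)
      ≈⟨ *-cong (^ρ≈^R (ℤ.- z) J) (*-cong (sign-card J) (reflexive (P.cong (ζ ^ℤ_) expo≡))) ⟩
    ζ ^ℤ (ℤ.- z ℤ.* R J) * (Π (tabulate signs) * ζ ^ℤ sumIf (lookup J) amd)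
      ≈⟨ *-cong (trans (reflexive (P.cong (ζ ^ℤ_) (*-distribˡ-sumIf (ℤ.- z) (lookup J) _))) (^ℤ-sumIf (lookup J) _))
                (*-congˡ (^ℤ-sumIf (lookup J) amd)) ⟩
    Π (tabulate shifts) * (Π (tabulate signs) * Π (tabulate powers))
      ≈⟨ trans (*-congˡ (sym (Π-distrib-* signs powers))) (sym (Π-distrib-* shifts _)) ⟩
    Π (tabulate (λ s → shifts s * (signs s * powers s)))
      ≈⟨ Π-cong factor ⟩
    Π (tabulate (λ s → if lookup J s then - twist z s else 1#)) ∎
    where
    amd : Fin k → ℤ
    amd s = a s ℤ.* m s ℤ.* + d s
    expo≡ : expo A m J ≡ sumIf (lookup J) amd
    expo≡ = P.cong (foldr ℤ._+_ (+ 0)) (map-allFin (λ s → if lookup J s then amd s else + 0))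
    signs shifts powers : Fin k → Carrier
    signs s  = if lookup J s then - 1# else 1#
    shifts s = if lookup J s then ζ ^ℤ (ℤ.- z ℤ.* (m s ℤ.* + d s)) else 1#
    powers s = if lookup J s then ζ ^ℤ amd s else 1#
    factor : ∀ s → shifts s * (signs s * powers s) ≈ (if lookup J s then - twist z s else 1#)
    factor s with lookup J s
    ... | false = trans (*-identityˡ _) (*-identityˡ _)
    ... | true  = signed-twist z s

  summand-expansion : ∀ z J → (ζ ^ℤ (ℤ.- z)) ^ℕ ρ J * term J
                      ≈ linearExtension (λ e → Π (tabulate (λ s → localFactor z e s (lookup J s)))) f
  summand-expansion z J = begin
    x * ((S * eval f (χ J)) * Z)
      ≈⟨ solve 4 (λ x s e z → x :* ((s :* e) :* z) := e :* (x :* (s :* z))) refl x S (eval f (χ J)) Z ⟩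
    eval f (χ J) * (x * (S * Z))
      ≈⟨ *-congˡ (weight-factorises z J) ⟩
    eval f (χ J) * Π (tabulate signedTwists)
      ≈⟨ *-distribʳ-Σ _ _ f ⟩
    Σ (map (λ t → (proj₁ t * Π (map (λ s → χ J s ^ℕ proj₂ t s) (allFin k))) * Π (tabulate signedTwists)) f)
      ≈⟨ Σ-cong f (λ t → trans (*-assoc _ _ _) (*-congˡ (begin
           Π (map (λ s → χ J s ^ℕ proj₂ t s) (allFin k)) * Π (tabulate signedTwists)
             ≡⟨ P.cong (λ xs → Π xs * Π (tabulate signedTwists)) (map-allFin (λ s → χ J s ^ℕ proj₂ t s)) ⟩
           Π (tabulate (λ s → χ J s ^ℕ proj₂ t s)) * Π (tabulate signedTwists)
             ≈⟨ Π-distrib-* _ signedTwists ⟨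
           Π (tabulate (λ s → localFactor z (proj₂ t) s (lookup J s))) ∎))) ⟩
    linearExtension (λ e → Π (tabulate (λ s → localFactor z e s (lookup J s)))) f ∎
    where
    open import Algebra.Solver.Ring.NaturalCoefficients.Default commutativeSemiring using (solve; _:*_; _:=_)
    x = (ζ ^ℤ (ℤ.- z)) ^ℕ ρ J
    S = sign (card J)
    Z = ζ ^ℤ expo A m J
    signedTwists : Fin k → Carrier
    signedTwists s = if lookup J s then - twist z s else 1#

  generating-function : ∀ z → polynomial classSum (N A) (ζ ^ℤ (ℤ.- z)) ≈ linearExtension (monomialValue z) f
  generating-function z = begin
    polynomial classSum (N A) x
      ≈⟨ Σ-collect-powers ρ term (N A) x (allSubsets k) ρ<N ⟨
    Σ (map (λ J → x ^ℕ ρ J * term J) (allSubsets k))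
      ≈⟨ Σ-cong (allSubsets k) (summand-expansion z) ⟩
    Σ (map (λ J → Σ (map (summand J) f)) (allSubsets k))
      ≈⟨ Σ-comm summand (allSubsets k) f ⟩
    Σ (map (λ t → Σ (map (λ J → summand J t) (allSubsets k))) f)
      ≈⟨ Σ-cong f (λ t → trans (sym (*-distribˡ-Σ (proj₁ t) _ (allSubsets k)))
                               (*-congˡ (Σ-allSubsets-Π k (localFactor z (proj₂ t))))) ⟩
    linearExtension (monomialValue z) f ∎
    where
    x = ζ ^ℤ (ℤ.- z)
    summand : Vec Bool k → Carrier × Exponent k → Carrier
    summand J t = proj₁ t * Π (tabulate (λ s → localFactor z (proj₂ t) s (lookup J s)))

  ∣twistExponent∣ : ∀ z s → ∣ twistExponent z s ∣ ≡ ∣ a s ℤ.- z ∣ ℕ.* ∣ m s ∣ ℕ.* d s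
  ∣twistExponent∣ z s = P.trans (ℤP.abs-* ((a s ℤ.- z) ℤ.* m s) (+ d s)) (P.cong (ℕ._* d s) (ℤP.abs-* (a s ℤ.- z) (m s)))

  ∈⇒twist≈1 : ∀ z s → z ∈RC a s , n s → twist z s ≈ 1#
  ∈⇒twist≈1 z s n∣z-a = Equivalence.from (^ℤ≈1⇔∣ (twistExponent z s))
    (P.subst₂ ℕD._∣_ (n*d≡N s) (P.sym (∣twistExponent∣ z s))
      (ℕD.*-monoˡ-∣ (d s) (ℕD.∣m⇒∣m*n ∣ m s ∣ (P.subst (n s ℕD.∣_) (ℤP.∣i-j∣≡∣j-i∣ z (a s)) n∣z-a))))

  twist≈1⇒∈ : ∀ z s → Coprime ∣ m s ∣ (n s) → twist z s ≈ 1# → z ∈RC a s , n s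
  twist≈1⇒∈ z s coprime twist≈1 = P.subst (n s ℕD.∣_) (ℤP.∣i-j∣≡∣j-i∣ (a s) z)
    (coprime-divisor (Coprimality.sym coprime) (P.subst (n s ℕD.∣_) (ℕP.*-comm ∣ a s ℤ.- z ∣ ∣ m s ∣)
      (ℕD.*-cancelʳ-∣ (d s) {{d≢0 s}} (P.subst₂ ℕD._∣_ (P.sym (n*d≡N s)) (∣twistExponent∣ z s)
        (Equivalence.to (^ℤ≈1⇔∣ (twistExponent z s)) twist≈1)))))

  twist≉0 : ∀ z s → ¬ twist z s ≈ 0#
  twist≉0 z s = ^ℤ-≉0 (twistExponent z s)

  totalDegree-indicator : ∀ z → totalDegree (indicatorExp F A z) ≡ w A z
  totalDegree-indicator z = count-true (λ s → z ∈RC? a s , n s) (allFin k)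

  monomialValue-≈0 : ∀ z e s → z ∈RC a s , n s → e s ≡ 0 → monomialValue z e ≈ 0#
  monomialValue-≈0 z e s z∈ es≡0 = Π-≈0 _ s (begin
    0# ^ℕ e s * 1# + 1# ^ℕ e s * - twist z s   ≡⟨ P.cong (λ t → 0# ^ℕ t * 1# + 1# ^ℕ t * - twist z s) es≡0 ⟩
    1# * 1# + 1# * - twist z s                 ≈⟨ +-cong (*-identityˡ 1#) (trans (*-identityˡ _) (-‿cong (∈⇒twist≈1 z s z∈))) ⟩
    1# - 1#                                    ≈⟨ -‿inverseʳ 1# ⟩
    0#                                         ∎)

  module _ {mA : ℕ} (cover : IsCoveringMultiplicity A mA) (deg : DegreeAtMost f mA) where

    -- A monomial not vanishing at the twists must contain ∏_{s∈I_z} x_s, so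
    -- it is that monomial or has degree above w_A(z) ≥ m(A).
    only-indicator-survives : ∀ z e → ¬ e ~ indicatorExp F A z → coeff f e * monomialValue z e ≈ 0#
    only-indicator-survives z e e≁ind with FinP.any? (λ s → (z ∈RC? a s , n s) ×-dec (e s ℕ.≟ 0))
    ... | yes (s , z∈ , es≡0) = trans (*-congˡ (monomialValue-≈0 z e s z∈ es≡0)) (zeroʳ _)
    ... | no ∄s = trans (*-congʳ (deg e mA<deg)) (zeroˡ _)
      where
      ind = indicatorExp F A z
      ind≤e : ∀ s → ind s ℕ.≤ e s
      ind≤e s with z ∈RC? a s , n s
      ... | yes z∈ = ℕP.n≢0⇒n>0 (λ es≡0 → ∄s (s , z∈ , es≡0))
      ... | no _   = ℕ.z≤n
      differ = FinP.¬∀⟶∃¬ k (λ s → e s ≡ ind s) (λ s → e s ℕ.≟ ind s) e≁ind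
      mA<deg : mA ℕ.< totalDegree e
      mA<deg = ℕP.≤-<-trans (proj₂ cover z) (P.subst₂ ℕ._<_
        (P.trans (P.cong (foldr ℕ._+_ 0) (P.sym (map-allFin ind))) (totalDegree-indicator z))
        (P.cong (foldr ℕ._+_ 0) (P.sym (map-allFin e)))
        (Σ-<-pointwise ind e ind≤e (proj₁ differ) (λ eq → proj₂ differ (P.sym eq))))

    generating-function-at : ∀ z → polynomial classSum (N A) (ζ ^ℤ (ℤ.- z))
                                   ≈ coeff f (indicatorExp F A z) * monomialValue z (indicatorExp F A z)
    generating-function-at z = trans (generating-function z)
      (linearExtension-single (monomialValue-respects~ z) f _ (only-indicator-survives z))

  monomialValue-indicator-≉0 : (∀ s → Coprime ∣ m s ∣ (n s)) → ∀ z → ¬ monomialValue z (indicatorExp F A z) ≈ 0#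
  monomialValue-indicator-≉0 coprime z = Π-≉0 _ factor≉0
    where
    factor≉0 : ∀ s → ¬ localFactor z (indicatorExp F A z) s false + localFactor z (indicatorExp F A z) s true ≈ 0#
    factor≉0 s with z ∈RC? a s , n s
    ... | yes _ = λ factor≈0 → twist≉0 z s (begin
      twist z s                                       ≈⟨ -‿involutive _ ⟨
      - - twist z s                                   ≈⟨ -‿cong (+-identityˡ _) ⟨
      - (0# + - twist z s)                            ≈⟨ -‿cong (+-cong (trans (*-identityʳ _) (zeroˡ _))
                                                                          (trans (*-congʳ (*-identityˡ 1#)) (*-identityˡ _))) ⟨
      - ((0# * 1# * 1#) + (1# * 1#) * - twist z s)    ≈⟨ -‿cong factor≈0 ⟩
      - 0#                                            ≈⟨ -0#≈0# ⟩
      0#                                              ∎)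
    ... | no z∉ = λ factor≈0 → z∉ (twist≈1⇒∈ z s (coprime s)
      (sym (x∙y⁻¹≈ε⇒x≈y _ _ (trans (sym (+-cong (*-identityˡ 1#) (*-identityˡ _))) factor≈0))))

lemma4p1 : ∀ {c ℓ : Level} (F : Field c ℓ) {k : ℕ} (A : System k) (m : Fin k → ℤ)
    (ζ : Field.Carrier F) → FieldOps.HasOrder F ζ (N A)
    → (mA : ℕ) → IsCoveringMultiplicity A mA
    → (f : FieldOps.Poly F k) → FieldOps.DegreeAtMost F f mA
    → ((∀ (z : ℤ) → Field._≈_ F (FieldOps.coeff F f (indicatorExp F A z)) (Field.0# F))
    → ∀ (θ : ℚ) → 0ℚ ≤ θ → θ < 1ℚ → Field._≈_ F (ψ F A m f ζ θ) (Field.0# F))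
    × ((∀ (s : Fin k) → Coprime ∣ m s ∣ (System.n A s))
    → (∀ (θ : ℚ) → 0ℚ ≤ θ → θ < 1ℚ → Field._≈_ F (ψ F A m f ζ θ) (Field.0# F))
    → ∀ (z : ℤ) → Field._≈_ F (FieldOps.coeff F f (indicatorExp F A z)) (Field.0# F))
lemma4p1 F A m ζ ord mA cover f deg = coefficients⇒ψ , ψ⇒coefficients
  where
  open Field F
  open FieldOps F
  open FieldProperties F
  open RootOfUnity ord
  open ClassSums F A m ord f
  open import Relation.Binary.Reasoning.Setoid setoid

  coefficients⇒ψ : (∀ z → coeff f (indicatorExp F A z) ≈ 0#) → ∀ θ → 0ℚ ≤ θ → θ < 1ℚ → ψ F A m f ζ θ ≈ 0#
  coefficients⇒ψ coeffs≈0 θ _ _ = classSums≈0⇒ψ≈0 (vanishing-coefficients (N A) ℕP.≤-refl classSum roots) θ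
    where
    roots : ∀ j → j ℕ.< N A → polynomial classSum (N A) (ζ ^ℕ j) ≈ 0#
    roots j _ = begin
      polynomial classSum (N A) (ζ ^ℕ j)                   ≡⟨ P.cong (λ t → polynomial classSum (N A) (ζ ^ℤ t)) (ℤP.neg-involutive (+ j)) ⟨
      polynomial classSum (N A) (ζ ^ℤ (ℤ.- z))             ≈⟨ generating-function-at cover deg z ⟩
      coeff f (indicatorExp F A z) * monomialValue z (indicatorExp F A z) ≈⟨ *-congʳ (coeffs≈0 z) ⟩
      0# * monomialValue z (indicatorExp F A z)            ≈⟨ zeroˡ _ ⟩
      0#                                                   ∎
      where z = ℤ.- + j

  ψ⇒coefficients : (∀ s → Coprime ∣ m s ∣ (System.n A s)) → (∀ θ → 0ℚ ≤ θ → θ < 1ℚ → ψ F A m f ζ θ ≈ 0#) →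
                   ∀ z → coeff f (indicatorExp F A z) ≈ 0#
  ψ⇒coefficients coprime ψ≈0 z = x*y≈0⇒x≈0 (monomialValue-indicator-≉0 coprime z)
    (trans (sym (generating-function-at cover deg z)) (polynomial-≈0 (N A) _ (ψ≈0⇒classSums≈0 ψ≈0)))
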